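{- Let $\{GM_n\}$ and $\{GR_n\}$ be the Gaussian Tetranacci and Gaussian Tetranacci-Lucas numbers (see context). Then for every integer $n$: \[ (4-i)GM_{2n}-(9-4i)GM_{2n-2}-(6-7i)GM_{2n-4}+(1+i)GM_{2n-6}=(1+i)GR_{2n-2}+(1-i)GR_{2n-4}-iGR_{2n-6}, \] \[ (1+4i)GM_{2n}+(4-9i)GM_{2n-2}+(2-6i)GM_{2n-4}+(1+i)GM_{2n-6}=(1+i)GR_{2n-1}+(1-i)GR_{2n-3}-iGR_{2n-5}, \] \[ (4-i)GM_{2n+1}-(9-4i)GM_{2n-1}-(6-7i)GM_{2n-3}+(1+i)GM_{2n-5}=GR_{2n}-(1-i)GR_{2n-2}-(1-i)GR_{2n-4}, \] \[ (1+4i)GM_{2n+1}+(4-9i)GM_{2n-1}+(2-6i)GM_{2n-3}+(1+i)GM_{2n-5}=GR_{2n+1}-(1-i)GR_{2n-1}-(1-i)GR_{2n-3}. \]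
   Context: The Tetranacci numbers $M_n$ and Tetranacci-Lucas numbers $R_n$ both satisfy $X_n=X_{n-1}+X_{n-2}+X_{n-3}+X_{n-4}$ for all integers $n$ (extended to negative indices so the recurrence holds for all $n\in\mathbb{Z}$), with $M_0=0,M_1=1,M_2=1,M_3=2$ and $R_0=4,R_1=1,R_2=3,R_3=7$. The Gaussian Tetranacci numbers are $GM_n=M_n+iM_{n-1}$ and the Gaussian Tetranacci-Lucas numbers are $GR_n=R_n+iR_{n-1}$, for all integers $n$ (so $GM_0=0,GM_1=1,GM_2=1+i,GM_3=2+i$ and $GR_0=4-i,GR_1=1+4i,GR_2=3+i,GR_3=7+3i$, both satisfying the same fourth-order recurrence). -}

module Defs where

open import Data.Nat using (ℕ; zero; suc)
open import Data.Integer using (ℤ; +_; -[1+_]; _+_; _-_; _*_; -_)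
open import Data.Product using (_×_; _,_; proj₁)
open import Relation.Binary.PropositionalEquality using (_≡_)

Quad : Set
Quad = ℤ × ℤ × ℤ × ℤ

-- forward: (X n , X (n+1) , X (n+2) , X (n+3)) for n ≥ 0
fwd : Quad → ℕ → Quad
fwd q zero = q
fwd q (suc n) with fwd q n
... | (a , b , c , d) = (b , c , d , a + b + c + d)

-- backward: (X (-k) , X (-k+1) , X (-k+2) , X (-k+3)), using
-- X (m-4) = X m - X (m-1) - X (m-2) - X (m-3)
bwd : Quad → ℕ → Quad
bwd q zero = q
bwd q (suc k) with bwd q k
... | (a , b , c , d) = (d - c - b - a , a , b , c)

-- The unique two-sided sequence X : ℤ → ℤ with
-- X 0 , X 1 , X 2 , X 3 = initial values and
-- X n = X (n-1) + X (n-2) + X (n-3) + X (n-4) for all n ∈ ℤ.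
tetraSeq : Quad → ℤ → ℤ
tetraSeq q (+ n)      = proj₁ (fwd q n)
tetraSeq q -[1+ k ]   = proj₁ (bwd q (suc k))

M : ℤ → ℤ
M = tetraSeq (+ 0 , + 1 , + 1 , + 2)

R : ℤ → ℤ
R = tetraSeq (+ 4 , + 1 , + 3 , + 7)

record ℤ[i] : Set where
  constructor _+_i
  field
    re : ℤ
    im : ℤ
open ℤ[i] public

infixl 6 _+G_ _-G_
infixl 7 _*G_

_+G_ : ℤ[i] → ℤ[i] → ℤ[i]
(a + b i) +G (c + d i) = (a + c) + (b + d) i

_-G_ : ℤ[i] → ℤ[i] → ℤ[i]
(a + b i) -G (c + d i) = (a - c) + (b - d) i

_*G_ : ℤ[i] → ℤ[i] → ℤ[i]
(a + b i) *G (c + d i) = (a * c - b * d) + (a * d + b * c) i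

gi : ℤ → ℤ → ℤ[i]
gi a b = a + b i

GM : ℤ → ℤ[i]
GM n = M n + M (n - + 1) i

GR : ℤ → ℤ[i]
GR n = R n + R (n - + 1) i

{-# OPTIONS --safe #-}
-- Each side of each identity, as a function of the index m, is a ℤ[i]-linear
-- combination of shifts of GM and GR, so its real and imaginary parts satisfy the
-- Tetranacci recurrence in m. A two-sided Tetranacci sequence is determined by four
-- consecutive values, so each identity holds for every m ∈ ℤ as soon as it holds at
-- m = 0, 1, 2, 3, which is a finite computation; the theorem is the case m = 2n.
module Submission where

open import Defs
open import Data.Nat using (zero; suc)
import Data.Nat.Properties as ℕ
open import Data.Integer using (ℤ; +_; -[1+_]; _+_; _-_; _*_; -_)
open import Data.Integer.Properties
  using (+-assoc; +-identityˡ; +-commutativeSemigroup; i≡j⇒i-j≡0; i-j≡0⇒i≡j)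
open import Algebra.Properties.CommutativeSemigroup +-commutativeSemigroup using (xy∙z≈xz∙y)
open import Data.Integer.Tactic.RingSolver using (solve-∀)
open import Data.Product using (_×_; _,_; proj₁)
open import Function using (_∘_)
open import Relation.Binary.PropositionalEquality
open ≡-Reasoning

record Tetranacci (f : ℤ → ℤ) : Set where
  field recurrence : ∀ m → f (m + + 4) ≡ f (m + + 3) + f (m + + 2) + f (m + + 1) + f m
open Tetranacci

private
  +-reverse : ∀ a b c d → a + b + c + d ≡ d + c + b + a
  +-reverse = solve-∀

  sub-then-add : ∀ a b c d → d ≡ c + b + a + (d - c - b - a)
  sub-then-add = solve-∀

  +-interchange : ∀ a b c d a′ b′ c′ d′ →
    (a + b + c + d) + (a′ + b′ + c′ + d′) ≡ (a + a′) + (b + b′) + (c + c′) + (d + d′)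
  +-interchange = solve-∀

  -‿interchange : ∀ a b c d a′ b′ c′ d′ →
    (a + b + c + d) - (a′ + b′ + c′ + d′) ≡ (a - a′) + (b - b′) + (c - c′) + (d - d′)
  -‿interchange = solve-∀

  *-distribˡ-+₄ : ∀ x a b c d → x * (a + b + c + d) ≡ x * a + x * b + x * c + x * d
  *-distribˡ-+₄ = solve-∀

  -- On negative indices bwd defines X m as X (m + 4) - X (m + 3) - X (m + 2) - X (m + 1).
  tetraSeq-backward : ∀ q m → let X = tetraSeq q in
    X (m + + 4) ≡ X (m + + 3) + X (m + + 2) + X (m + + 1) + (X (m + + 4) - X (m + + 3) - X (m + + 2) - X (m + + 1))
  tetraSeq-backward q m = sub-then-add (X (m + + 1)) (X (m + + 2)) (X (m + + 3)) (X (m + + 4))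
    where
      X : ℤ → ℤ
      X = tetraSeq q

tetraSeq-tetranacci : ∀ q → Tetranacci (tetraSeq q)
tetraSeq-tetranacci q .recurrence (+ n)
  rewrite ℕ.+-comm n 4 | ℕ.+-comm n 3 | ℕ.+-comm n 2 | ℕ.+-comm n 1
  = let (a , b , c , d) = fwd q n in +-reverse a b c d
-- The case split only serves to let m + + 4 compute.
tetraSeq-tetranacci q .recurrence m@(-[1+ 0 ])                       = tetraSeq-backward q m
tetraSeq-tetranacci q .recurrence m@(-[1+ 1 ])                       = tetraSeq-backward q m
tetraSeq-tetranacci q .recurrence m@(-[1+ 2 ])                       = tetraSeq-backward q m
tetraSeq-tetranacci q .recurrence m@(-[1+ 3 ])                       = tetraSeq-backward q m
tetraSeq-tetranacci q .recurrence m@(-[1+ suc (suc (suc (suc _))) ]) = tetraSeq-backward q m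

tetranacci-shift : ∀ {f} → Tetranacci f → ∀ j → Tetranacci (λ m → f (m + j))
tetranacci-shift tf j .recurrence m
  rewrite xy∙z≈xz∙y m (+ 4) j | xy∙z≈xz∙y m (+ 3) j | xy∙z≈xz∙y m (+ 2) j | xy∙z≈xz∙y m (+ 1) j
  = recurrence tf (m + j)

tetranacci-add : ∀ {f g} → Tetranacci f → Tetranacci g → Tetranacci (λ m → f m + g m)
tetranacci-add {f} {g} tf tg .recurrence m rewrite recurrence tf m | recurrence tg m =
  +-interchange (f (m + + 3)) (f (m + + 2)) (f (m + + 1)) (f m) (g (m + + 3)) (g (m + + 2)) (g (m + + 1)) (g m)

tetranacci-sub : ∀ {f g} → Tetranacci f → Tetranacci g → Tetranacci (λ m → f m - g m)
tetranacci-sub {f} {g} tf tg .recurrence m rewrite recurrence tf m | recurrence tg m =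
  -‿interchange (f (m + + 3)) (f (m + + 2)) (f (m + + 1)) (f m) (g (m + + 3)) (g (m + + 2)) (g (m + + 1)) (g m)

tetranacci-scale : ∀ {f} c → Tetranacci f → Tetranacci (λ m → c * f m)
tetranacci-scale {f} c tf .recurrence m rewrite recurrence tf m =
  *-distribˡ-+₄ c (f (m + + 3)) (f (m + + 2)) (f (m + + 1)) (f m)

ZeroWindow : (ℤ → ℤ) → ℤ → Set
ZeroWindow f m = f m ≡ + 0 × f (m + + 1) ≡ + 0 × f (m + + 2) ≡ + 0 × f (m + + 3) ≡ + 0

module _ {f : ℤ → ℤ} (tf : Tetranacci f) where

  private
    reassoc : ∀ m k → f (m + + suc k) ≡ + 0 → f (m + + 1 + + k) ≡ + 0
    reassoc m k = subst (λ i → f i ≡ + 0) (sym (+-assoc m (+ 1) (+ k)))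

    unassoc : ∀ m k → f (m + + 1 + + k) ≡ + 0 → f (m + + suc k) ≡ + 0
    unassoc m k = subst (λ i → f i ≡ + 0) (+-assoc m (+ 1) (+ k))

  zeroWindow-suc : ∀ m → ZeroWindow f m → ZeroWindow f (m + + 1)
  zeroWindow-suc m (z₀ , z₁ , z₂ , z₃) = z₁ , reassoc m 1 z₂ , reassoc m 2 z₃ , reassoc m 3 z₄
    where
      z₄ : f (m + + 4) ≡ + 0
      z₄ = trans (recurrence tf m) (cong₂ _+_ (cong₂ _+_ (cong₂ _+_ z₃ z₂) z₁) z₀)

  zeroWindow-pred : ∀ m → ZeroWindow f (m + + 1) → ZeroWindow f m
  zeroWindow-pred m (z₁ , z₂ , z₃ , z₄) = z₀ , z₁ , unassoc m 1 z₂ , unassoc m 2 z₃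
    where
      z₀ : f m ≡ + 0
      z₀ = sym (begin
        + 0                                           ≡⟨ sym (unassoc m 3 z₄) ⟩
        f (m + + 4)                                   ≡⟨ recurrence tf m ⟩
        f (m + + 3) + f (m + + 2) + f (m + + 1) + f m
          ≡⟨ cong (_+ f m) (cong₂ _+_ (cong₂ _+_ (unassoc m 2 z₃) (unassoc m 1 z₂)) z₁) ⟩
        + 0 + f m                                     ≡⟨ +-identityˡ (f m) ⟩
        f m                                           ∎)

  tetranacci-zero : ZeroWindow f (+ 0) → ∀ m → f m ≡ + 0
  tetranacci-zero w m = proj₁ (window m)
    where
      window : ∀ m → ZeroWindow f m
      window (+ zero)     = w
      window (+ suc n)    = subst (ZeroWindow f ∘ +_) (ℕ.+-comm n 1) (zeroWindow-suc (+ n) (window (+ n)))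
      window -[1+ zero ]  = zeroWindow-pred -[1+ zero ] w
      window -[1+ suc k ] = zeroWindow-pred -[1+ suc k ] (window -[1+ k ])

tetranacci-ext : ∀ {f g} → Tetranacci f → Tetranacci g →
  f (+ 0) ≡ g (+ 0) → f (+ 1) ≡ g (+ 1) → f (+ 2) ≡ g (+ 2) → f (+ 3) ≡ g (+ 3) →
  ∀ m → f m ≡ g m
tetranacci-ext tf tg e₀ e₁ e₂ e₃ m =
  i-j≡0⇒i≡j _ _ (tetranacci-zero (tetranacci-sub tf tg)
    (i≡j⇒i-j≡0 e₀ , i≡j⇒i-j≡0 e₁ , i≡j⇒i-j≡0 e₂ , i≡j⇒i-j≡0 e₃) m)

record Tetranacciᴳ (F : ℤ → ℤ[i]) : Set where
  constructor tetranacciᴳ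
  field
    re-tetranacci : Tetranacci (re ∘ F)
    im-tetranacci : Tetranacci (im ∘ F)

tetranacciᴳ-shift : ∀ {F} → Tetranacciᴳ F → ∀ j → Tetranacciᴳ (λ m → F (m + j))
tetranacciᴳ-shift (tetranacciᴳ tr ti) j = tetranacciᴳ (tetranacci-shift tr j) (tetranacci-shift ti j)

infixl 6 _⊕_ _⊖_
infixl 7 _⊛_

_⊕_ : ∀ {F G} → Tetranacciᴳ F → Tetranacciᴳ G → Tetranacciᴳ (λ m → F m +G G m)
tetranacciᴳ tr ti ⊕ tetranacciᴳ tr′ ti′ = tetranacciᴳ (tetranacci-add tr tr′) (tetranacci-add ti ti′)

_⊖_ : ∀ {F G} → Tetranacciᴳ F → Tetranacciᴳ G → Tetranacciᴳ (λ m → F m -G G m)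
tetranacciᴳ tr ti ⊖ tetranacciᴳ tr′ ti′ = tetranacciᴳ (tetranacci-sub tr tr′) (tetranacci-sub ti ti′)

_⊛_ : ∀ {F} c → Tetranacciᴳ F → Tetranacciᴳ (λ m → c *G F m)
c ⊛ tetranacciᴳ tr ti =
  tetranacciᴳ (tetranacci-sub (tetranacci-scale (re c) tr) (tetranacci-scale (im c) ti))
              (tetranacci-add (tetranacci-scale (re c) ti) (tetranacci-scale (im c) tr))

tetranacciᴳ-ext : ∀ {F G} → Tetranacciᴳ F → Tetranacciᴳ G →
  F (+ 0) ≡ G (+ 0) → F (+ 1) ≡ G (+ 1) → F (+ 2) ≡ G (+ 2) → F (+ 3) ≡ G (+ 3) →
  ∀ m → F m ≡ G m
tetranacciᴳ-ext (tetranacciᴳ tr ti) (tetranacciᴳ tr′ ti′) e₀ e₁ e₂ e₃ m = cong₂ _+_i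
  (tetranacci-ext tr tr′ (cong re e₀) (cong re e₁) (cong re e₂) (cong re e₃) m)
  (tetranacci-ext ti ti′ (cong im e₀) (cong im e₁) (cong im e₂) (cong im e₃) m)

GM-tetranacciᴳ : Tetranacciᴳ GM
GM-tetranacciᴳ = tetranacciᴳ (tetraSeq-tetranacci _) (tetranacci-shift (tetraSeq-tetranacci _) (- + 1))

GR-tetranacciᴳ : Tetranacciᴳ GR
GR-tetranacciᴳ = tetranacciᴳ (tetraSeq-tetranacci _) (tetranacci-shift (tetraSeq-tetranacci _) (- + 1))

private
  GM↑ : ∀ j → Tetranacciᴳ (λ m → GM (m + j))
  GM↑ = tetranacciᴳ-shift GM-tetranacciᴳ

  GR↑ : ∀ j → Tetranacciᴳ (λ m → GR (m + j))
  GR↑ = tetranacciᴳ-shift GR-tetranacciᴳ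

GM-GR-identity₁ : ∀ m →
  gi (+ 4) (- + 1) *G GM m -G gi (+ 9) (- + 4) *G GM (m - + 2)
    -G gi (+ 6) (- + 7) *G GM (m - + 4) +G gi (+ 1) (+ 1) *G GM (m - + 6)
  ≡ gi (+ 1) (+ 1) *G GR (m - + 2) +G gi (+ 1) (- + 1) *G GR (m - + 4)
    -G gi (+ 0) (+ 1) *G GR (m - + 6)
GM-GR-identity₁ = tetranacciᴳ-ext
  (gi (+ 4) (- + 1) ⊛ GM-tetranacciᴳ ⊖ gi (+ 9) (- + 4) ⊛ GM↑ (- + 2)
    ⊖ gi (+ 6) (- + 7) ⊛ GM↑ (- + 4) ⊕ gi (+ 1) (+ 1) ⊛ GM↑ (- + 6))
  (gi (+ 1) (+ 1) ⊛ GR↑ (- + 2) ⊕ gi (+ 1) (- + 1) ⊛ GR↑ (- + 4) ⊖ gi (+ 0) (+ 1) ⊛ GR↑ (- + 6))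
  refl refl refl refl

GM-GR-identity₂ : ∀ m →
  gi (+ 1) (+ 4) *G GM m +G gi (+ 4) (- + 9) *G GM (m - + 2)
    +G gi (+ 2) (- + 6) *G GM (m - + 4) +G gi (+ 1) (+ 1) *G GM (m - + 6)
  ≡ gi (+ 1) (+ 1) *G GR (m - + 1) +G gi (+ 1) (- + 1) *G GR (m - + 3)
    -G gi (+ 0) (+ 1) *G GR (m - + 5)
GM-GR-identity₂ = tetranacciᴳ-ext
  (gi (+ 1) (+ 4) ⊛ GM-tetranacciᴳ ⊕ gi (+ 4) (- + 9) ⊛ GM↑ (- + 2)
    ⊕ gi (+ 2) (- + 6) ⊛ GM↑ (- + 4) ⊕ gi (+ 1) (+ 1) ⊛ GM↑ (- + 6))
  (gi (+ 1) (+ 1) ⊛ GR↑ (- + 1) ⊕ gi (+ 1) (- + 1) ⊛ GR↑ (- + 3) ⊖ gi (+ 0) (+ 1) ⊛ GR↑ (- + 5))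
  refl refl refl refl

GM-GR-identity₃ : ∀ m →
  gi (+ 4) (- + 1) *G GM (m + + 1) -G gi (+ 9) (- + 4) *G GM (m - + 1)
    -G gi (+ 6) (- + 7) *G GM (m - + 3) +G gi (+ 1) (+ 1) *G GM (m - + 5)
  ≡ GR m -G gi (+ 1) (- + 1) *G GR (m - + 2) -G gi (+ 1) (- + 1) *G GR (m - + 4)
GM-GR-identity₃ = tetranacciᴳ-ext
  (gi (+ 4) (- + 1) ⊛ GM↑ (+ 1) ⊖ gi (+ 9) (- + 4) ⊛ GM↑ (- + 1)
    ⊖ gi (+ 6) (- + 7) ⊛ GM↑ (- + 3) ⊕ gi (+ 1) (+ 1) ⊛ GM↑ (- + 5))
  (GR-tetranacciᴳ ⊖ gi (+ 1) (- + 1) ⊛ GR↑ (- + 2) ⊖ gi (+ 1) (- + 1) ⊛ GR↑ (- + 4))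
  refl refl refl refl

GM-GR-identity₄ : ∀ m →
  gi (+ 1) (+ 4) *G GM (m + + 1) +G gi (+ 4) (- + 9) *G GM (m - + 1)
    +G gi (+ 2) (- + 6) *G GM (m - + 3) +G gi (+ 1) (+ 1) *G GM (m - + 5)
  ≡ GR (m + + 1) -G gi (+ 1) (- + 1) *G GR (m - + 1) -G gi (+ 1) (- + 1) *G GR (m - + 3)
GM-GR-identity₄ = tetranacciᴳ-ext
  (gi (+ 1) (+ 4) ⊛ GM↑ (+ 1) ⊕ gi (+ 4) (- + 9) ⊛ GM↑ (- + 1)
    ⊕ gi (+ 2) (- + 6) ⊛ GM↑ (- + 3) ⊕ gi (+ 1) (+ 1) ⊛ GM↑ (- + 5))
  (GR↑ (+ 1) ⊖ gi (+ 1) (- + 1) ⊛ GR↑ (- + 1) ⊖ gi (+ 1) (- + 1) ⊛ GR↑ (- + 3))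
  refl refl refl refl

mainTheorem18 : (n : ℤ) →
    (gi (+ 4) (- + 1) *G GM (+ 2 * n) -G gi (+ 9) (- + 4) *G GM (+ 2 * n - + 2)
      -G gi (+ 6) (- + 7) *G GM (+ 2 * n - + 4) +G gi (+ 1) (+ 1) *G GM (+ 2 * n - + 6)
      ≡ gi (+ 1) (+ 1) *G GR (+ 2 * n - + 2) +G gi (+ 1) (- + 1) *G GR (+ 2 * n - + 4)
        -G gi (+ 0) (+ 1) *G GR (+ 2 * n - + 6))
  × (gi (+ 1) (+ 4) *G GM (+ 2 * n) +G gi (+ 4) (- + 9) *G GM (+ 2 * n - + 2)
      +G gi (+ 2) (- + 6) *G GM (+ 2 * n - + 4) +G gi (+ 1) (+ 1) *G GM (+ 2 * n - + 6)
      ≡ gi (+ 1) (+ 1) *G GR (+ 2 * n - + 1) +G gi (+ 1) (- + 1) *G GR (+ 2 * n - + 3)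
        -G gi (+ 0) (+ 1) *G GR (+ 2 * n - + 5))
  × (gi (+ 4) (- + 1) *G GM (+ 2 * n + + 1) -G gi (+ 9) (- + 4) *G GM (+ 2 * n - + 1)
      -G gi (+ 6) (- + 7) *G GM (+ 2 * n - + 3) +G gi (+ 1) (+ 1) *G GM (+ 2 * n - + 5)
      ≡ GR (+ 2 * n) -G gi (+ 1) (- + 1) *G GR (+ 2 * n - + 2)
        -G gi (+ 1) (- + 1) *G GR (+ 2 * n - + 4))
  × (gi (+ 1) (+ 4) *G GM (+ 2 * n + + 1) +G gi (+ 4) (- + 9) *G GM (+ 2 * n - + 1)
      +G gi (+ 2) (- + 6) *G GM (+ 2 * n - + 3) +G gi (+ 1) (+ 1) *G GM (+ 2 * n - + 5)
      ≡ GR (+ 2 * n + + 1) -G gi (+ 1) (- + 1) *G GR (+ 2 * n - + 1)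
        -G gi (+ 1) (- + 1) *G GR (+ 2 * n - + 3))
mainTheorem18 n = GM-GR-identity₁ m , GM-GR-identity₂ m , GM-GR-identity₃ m , GM-GR-identity₄ m
  where
    m : ℤ
    m = + 2 * n
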